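{- Every graph that has exactly one component containing an edge, this component being a shooting star (all other components being isolated vertices), is line $[B,-]$-nice.
   Context: For $m,n\in\mathbb N$, an $(m,n)$-shooting star has vertices $v,w,a,b,x_1,\dots,x_m,y_1,\dots,y_n$ and edges $wv,va,ab$, $wx_i$ ($1\le i\le m$) and $vy_j$ ($1\le j\le n$). In the $[B,-]$-edge colouring game with $k$ colours, Bob and Alice alternately colour a previously uncoloured edge with one of $k$ colours so that edges sharing an endpoint get distinct colours; Bob moves first; no player may skip. The game ends when no move is possible; Alice wins iff all edges are coloured. A graph $G$ is line $[B,-]$-nice if the least $k$ for which Alice has a winning strategy equals $\omega(L(G))$, the maximum number of pairwise adjacent edges of $G$. -}

module Defs where

open import Data.Nat using (ℕ; _≤_; _<_)
open import Data.Fin using (Fin)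
import Data.Fin.Properties as FinP
open import Data.Maybe using (Maybe; just; nothing)
open import Data.Product using (Σ; ∃; ∃-syntax; _×_; _,_; proj₁; proj₂)
open import Data.Sum using (_⊎_)
open import Data.List using (List; length)
open import Data.List.Relation.Unary.AllPairs using (AllPairs)
open import Relation.Nullary using (¬_; yes; no)
open import Relation.Binary.Definitions using (DecidableEquality)
open import Relation.Binary.PropositionalEquality using (_≡_; refl; cong)

-- Finite graphs given by a vertex set, an edge set and the two
-- endpoints of each edge (decidable equality on edges is needed to
-- update a partial edge colouring).

record Graph : Set₁ where
  field
    V    : Set
    E    : Set
    ends : E → V × V
    _≟E_ : DecidableEquality E

module _ (G : Graph) where
  open Graph G

  _∈ₑ_ : V → E → Set
  u ∈ₑ e = u ≡ proj₁ (ends e) ⊎ u ≡ proj₂ (ends e)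

  -- two distinct edges sharing an endpoint (adjacency in L(G))
  Adjacent : E → E → Set
  Adjacent e f = ¬ (e ≡ f) × ∃[ u ] (u ∈ₑ e × u ∈ₑ f)

  IsClique : List E → Set
  IsClique es = AllPairs Adjacent es

  IsCliqueNumber : ℕ → Set
  IsCliqueNumber w =
    (∃[ es ] (IsClique es × length es ≡ w)) ×
    (∀ es → IsClique es → length es ≤ w)

  Colouring : ℕ → Set
  Colouring k = E → Maybe (Fin k)

  emptyColouring : ∀ {k} → Colouring k
  emptyColouring _ = nothing

  Complete : ∀ {k} → Colouring k → Set
  Complete c = ∀ e → ∃[ col ] (c e ≡ just col)

  Legal : ∀ {k} → Colouring k → E → Fin k → Set
  Legal c e col = c e ≡ nothing × (∀ f → Adjacent e f → ¬ (c f ≡ just col))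

  update : ∀ {k} → Colouring k → E → Fin k → Colouring k
  update c e col f with f ≟E e
  ... | yes _ = just col
  ... | no _  = c f

  data Player : Set where
    bob alice : Player

  -- AliceWins k p c : in position c with player p to move, Alice has a
  -- winning strategy in the edge colouring game with k colours.
  -- (The game is finite, so winning strategies are well-founded trees.)
  -- The game ends when no legal move exists; Alice wins iff then all
  -- edges are coloured.  No player may skip.
  data AliceWins (k : ℕ) : Player → Colouring k → Set where
    complete  : ∀ {p c} → Complete c → AliceWins k p c
    aliceMove : ∀ {c} e col → Legal c e col →
                AliceWins k bob (update c e col) → AliceWins k alice c
    bobMove   : ∀ {c} → (∃[ e ] ∃[ col ] Legal c e col) →
                (∀ e col → Legal c e col → AliceWins k alice (update c e col)) →
                AliceWins k bob c

  -- [B,-]-game: Bob moves first, from the empty colouring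
  AliceWinsB- : ℕ → Set
  AliceWinsB- k = AliceWins k bob emptyColouring

  IsGameChromaticIndexB- : ℕ → Set
  IsGameChromaticIndexB- w = AliceWinsB- w × (∀ k → k < w → ¬ AliceWinsB- k)

  LineB-Nice : Set
  LineB-Nice = Σ ℕ λ w → IsCliqueNumber w × IsGameChromaticIndexB- w

data SSVertex (m n p : ℕ) : Set where
  v w a b : SSVertex m n p
  x       : Fin m → SSVertex m n p
  y       : Fin n → SSVertex m n p
  iso     : Fin p → SSVertex m n p

data SSEdge (m n : ℕ) : Set where
  wv va ab : SSEdge m n
  wx       : Fin m → SSEdge m n
  vy       : Fin n → SSEdge m n

ssEnds : ∀ {m n p} → SSEdge m n → SSVertex m n p × SSVertex m n p
ssEnds wv     = w , v
ssEnds va     = v , a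
ssEnds ab     = a , b
ssEnds (wx i) = w , x i
ssEnds (vy j) = v , y j

ssEdge-≟ : ∀ {m n} → DecidableEquality (SSEdge m n)
ssEdge-≟ wv wv = yes refl
ssEdge-≟ wv va = no λ ()
ssEdge-≟ wv ab = no λ ()
ssEdge-≟ wv (wx _) = no λ ()
ssEdge-≟ wv (vy _) = no λ ()
ssEdge-≟ va wv = no λ ()
ssEdge-≟ va va = yes refl
ssEdge-≟ va ab = no λ ()
ssEdge-≟ va (wx _) = no λ ()
ssEdge-≟ va (vy _) = no λ ()
ssEdge-≟ ab wv = no λ ()
ssEdge-≟ ab va = no λ ()
ssEdge-≟ ab ab = yes refl
ssEdge-≟ ab (wx _) = no λ ()
ssEdge-≟ ab (vy _) = no λ ()
ssEdge-≟ (wx _) wv = no λ ()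
ssEdge-≟ (wx _) va = no λ ()
ssEdge-≟ (wx _) ab = no λ ()
ssEdge-≟ (wx i) (wx j) with FinP._≟_ i j
... | yes refl = yes refl
... | no i≢j = no λ { refl → i≢j refl }
ssEdge-≟ (wx _) (vy _) = no λ ()
ssEdge-≟ (vy _) wv = no λ ()
ssEdge-≟ (vy _) va = no λ ()
ssEdge-≟ (vy _) ab = no λ ()
ssEdge-≟ (vy _) (wx _) = no λ ()
ssEdge-≟ (vy i) (vy j) with FinP._≟_ i j
... | yes refl = yes refl
... | no i≢j = no λ { refl → i≢j refl }

ShootingStarPlusIsolated : ℕ → ℕ → ℕ → Graph
ShootingStarPlusIsolated m n p = record
  { V    = SSVertex m n p
  ; E    = SSEdge m n
  ; ends = ssEnds
  ; _≟E_ = ssEdge-≟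
  }

-- The edges at w and the edges at v form cliques of L(G) of sizes m + 1 and n + 2, and a
-- winning play always ends in a proper colouring, so Alice needs at least
-- ω = max (m + 1) (n + 2) colours. With k ≥ ω colours every edge other than wv and va has a
-- leaf as an endpoint, hence at most k − 1 colours around it, and can never get stuck.
-- The edge va cannot get stuck either once ab carries a colour that already occurs at v:
-- then the colours around va are those of at most n + 1 edges at v. So Alice only has to
-- colour wv, and colour va or shield it in this way, which she does in her first two moves:
-- if Bob starts on wv or va she colours the other one; if he colours ab she gives wv the
-- same colour; if he colours some wx i she gives va the same colour, and if some vy j, she
-- gives ab the same colour; in the last two cases at most two colours surround wv after
-- Bob's second move, and she colours it.
module Submission where

open import Defs
open import Data.Nat using (ℕ; zero; suc; _+_; _≤_; _<_; z≤n; s≤s; s≤s⁻¹)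
open import Data.Nat.Properties
  using ( ≤-reflexive; ≤-refl; ≤-trans; ≤-total; <⇒≱; +-mono-≤; +-mono-<-≤; +-mono-≤-<; +-suc; +-comm
        ; m≤n⇒m≤1+n)
open import Data.Nat.ListAction using (sum)
open import Data.Fin using (Fin; zero; suc)
import Data.Fin.Properties as Fin
open import Data.Maybe using (Maybe; just; nothing)
open import Data.Maybe.Properties using (just-injective)
open import Data.Product using (∃; _×_; _,_; proj₁; proj₂)
open import Data.Sum using (_⊎_; inj₁; inj₂)
open import Data.List using (List; []; _∷_; _++_; length; lookup; map; mapMaybe; tabulate)
open import Data.List.Properties using (length-++; length-tabulate)
open import Data.List.Relation.Unary.All using (All; []; _∷_)
import Data.List.Relation.Unary.All as All
import Data.List.Relation.Unary.All.Properties as All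
open import Data.List.Relation.Unary.AllPairs using (AllPairs; []; _∷_)
import Data.List.Relation.Unary.AllPairs.Properties as AllPairs
open import Data.List.Relation.Unary.Any using (here; there; index)
open import Data.List.Relation.Unary.Any.Properties using (lookup-index)
open import Data.List.Membership.Propositional using (_∈_; _∉_)
open import Data.List.Membership.Propositional.Properties
  using (∈-++⁺ˡ; ∈-++⁺ʳ; ∈-++⁻; ∈-lookup; ∈-tabulate⁺)
import Data.List.Membership.DecPropositional as DecMembership
open import Data.Empty using (⊥-elim)
open import Function using (_∘_)
open import Relation.Binary.Definitions using (Symmetric)
open import Relation.Binary.PropositionalEquality using (_≡_; _≢_; refl; sym; trans; cong; subst)
open import Relation.Nullary using (¬_; yes; no; contradiction)

private variable
  A B : Set
  k : ℕ

length<⇒∃∉ : (L : List (Fin k)) → length L < k → ∃ λ col → col ∉ L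
length<⇒∃∉ {k} L L<k with Fin.all? (λ col → DecMembership._∈?_ Fin._≟_ col L)
... | no ¬all = Fin.¬∀⟶∃¬ k _ (λ col → DecMembership._∈?_ Fin._≟_ col L) ¬all
... | yes all = contradiction (Fin.injective⇒≤ index-injective) (<⇒≱ L<k)
  where
  index-injective : ∀ {i j} → index (all i) ≡ index (all j) → i ≡ j
  index-injective {i} {j} eq =
    trans (lookup-index (all i)) (trans (cong (lookup L) eq) (sym (lookup-index (all j))))

distinct⇒2≤ : ∀ {m} {i j : Fin m} → i ≢ j → 2 ≤ m
distinct⇒2≤ {suc (suc _)} _                  = s≤s (s≤s z≤n)
distinct⇒2≤ {suc zero}    {zero} {zero} i≢j = contradiction refl i≢j

AllPairs-lookup : ∀ {R : A → A → Set} → Symmetric R → ∀ {xs} → AllPairs R xs →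
                  ∀ {i j} → i ≢ j → R (lookup xs i) (lookup xs j)
AllPairs-lookup sym-R (_ ∷ _)  {zero}  {zero}  i≢j = contradiction refl i≢j
AllPairs-lookup sym-R (r ∷ _)  {zero}  {suc j} _   = All.lookup r (∈-lookup j)
AllPairs-lookup sym-R (r ∷ _)  {suc i} {zero}  _   = sym-R (All.lookup r (∈-lookup i))
AllPairs-lookup sym-R (_ ∷ rs) {suc i} {suc j} i≢j = AllPairs-lookup sym-R rs (i≢j ∘ cong suc)

just⇒≢nothing : ∀ {s : Maybe A} {r} → s ≡ just r → s ≢ nothing
just⇒≢nothing refl ()

#nothing : Maybe A → ℕ
#nothing nothing  = 1
#nothing (just _) = 0

#nothing-anti : ∀ {s t : Maybe A} → (∀ {r} → s ≡ just r → t ≡ just r) → #nothing t ≤ #nothing s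
#nothing-anti {s = nothing} {nothing} _           = s≤s z≤n
#nothing-anti {s = nothing} {just _}  _           = z≤n
#nothing-anti {s = just _}  s⇒t rewrite s⇒t refl = z≤n

#nothing-fill : ∀ {s t : Maybe A} {r} → s ≡ nothing → t ≡ just r → #nothing t < #nothing s
#nothing-fill refl refl = s≤s z≤n

∈-mapMaybe⁺ : ∀ {f : A → Maybe B} {s r ss} → s ∈ ss → f s ≡ just r → r ∈ mapMaybe f ss
∈-mapMaybe⁺ (here refl) fs≡r rewrite fs≡r = here refl
∈-mapMaybe⁺ {f = f} {ss = t ∷ _} (there s∈ss) fs≡r with f t
... | nothing = ∈-mapMaybe⁺ s∈ss fs≡r
... | just _  = there (∈-mapMaybe⁺ s∈ss fs≡r)

∈-mapMaybe⁻ : ∀ {f : A → Maybe B} {r} (ss : List A) → r ∈ mapMaybe f ss →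
              ∃ λ s → s ∈ ss × f s ≡ just r
∈-mapMaybe⁻ {f = f} (s ∷ ss) r∈ with f s in fs | r∈
... | nothing | r∈′       = let (t , t∈ss , ft) = ∈-mapMaybe⁻ ss r∈′ in t , there t∈ss , ft
... | just _  | here refl = s , here refl , fs
... | just _  | there r∈′ = let (t , t∈ss , ft) = ∈-mapMaybe⁻ ss r∈′ in t , there t∈ss , ft

length-mapMaybe-≤ : ∀ (f : A → Maybe B) ss → length (mapMaybe f ss) ≤ length ss
length-mapMaybe-≤ f []       = z≤n
length-mapMaybe-≤ f (s ∷ ss) with f s
... | nothing = m≤n⇒m≤1+n (length-mapMaybe-≤ f ss)
... | just _  = s≤s (length-mapMaybe-≤ f ss)

length-mapMaybe-< : ∀ {f : A → Maybe B} {s ss} → s ∈ ss → f s ≡ nothing →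
                    length (mapMaybe f ss) < length ss
length-mapMaybe-< {f = f} {ss = _ ∷ ss} (here refl) fs≡nothing rewrite fs≡nothing =
  s≤s (length-mapMaybe-≤ f ss)
length-mapMaybe-< {f = f} {ss = t ∷ _} (there s∈ss) fs≡nothing with f t
... | nothing = m≤n⇒m≤1+n (length-mapMaybe-< s∈ss fs≡nothing)
... | just _  = s≤s (length-mapMaybe-< s∈ss fs≡nothing)

module EdgeColouring (G : Graph) where
  open Graph G

  private variable
    c c′ : Colouring G k
    e f : E
    col d : Fin k
    L : List (Fin k)
    es : List E

  Adjacent-sym : Adjacent G e f → Adjacent G f e
  Adjacent-sym (e≢f , u , u∈e , u∈f) = e≢f ∘ sym , u , u∈f , u∈e

  clique-at : ∀ {u} → All (_∈ₑ_ G u) es → AllPairs _≢_ es → IsClique G es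
  clique-at [] [] = []
  clique-at (u∈e ∷ u∈es) (e∉es ∷ distinct) =
    All.zipWith (λ (e≢f , u∈f) → e≢f , _ , u∈e , u∈f) (e∉es , u∈es) ∷ clique-at u∈es distinct

  update-≡ : update G c e col e ≡ just col
  update-≡ {e = e} with e ≟E e
  ... | yes _   = refl
  ... | no e≢e = contradiction refl e≢e

  update-just : update G c e col f ≡ just d → f ≡ e × col ≡ d ⊎ c f ≡ just d
  update-just {e = e} {f = f} eq with f ≟E e
  ... | yes f≡e = inj₁ (f≡e , just-injective eq)
  ... | no _    = inj₂ eq

  Coloured : Colouring G k → E → Set
  Coloured c e = ∃ λ d → c e ≡ just d

  coloured? : (c : Colouring G k) (e : E) → Coloured c e ⊎ c e ≡ nothing
  coloured? c e with c e
  ... | just d  = inj₁ (d , refl)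
  ... | nothing = inj₂ refl

  -- A record rather than a function type, so that both colourings can be inferred.
  record _⊑_ (c c′ : Colouring G k) : Set where
    field keeps : ∀ {e d} → c e ≡ just d → c′ e ≡ just d
  open _⊑_ public

  coloured-⊑ : c ⊑ c′ → Coloured c e → Coloured c′ e
  coloured-⊑ c⊑c′ (d , ce) = d , keeps c⊑c′ ce

  legal-⊑ : Legal G c e col → c ⊑ update G c e col
  keeps (legal-⊑ {e = e} (free , _)) {f} cf with f ≟E e
  ... | yes refl = contradiction free (just⇒≢nothing cf)
  ... | no _     = cf

  NeighbourColoursIn : Colouring G k → E → List (Fin k) → Set
  NeighbourColoursIn c e L = ∀ {f d} → Adjacent G e f → c f ≡ just d → d ∈ L

  neighbourColours-empty : NeighbourColoursIn (emptyColouring G) e L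
  neighbourColours-empty _ ()

  neighbourColours-update : (Adjacent G e f → col ∈ L) → NeighbourColoursIn c e L →
                            NeighbourColoursIn (update G c f col) e L
  neighbourColours-update col∈L around adj eq with update-just eq
  ... | inj₁ (refl , refl) = col∈L adj
  ... | inj₂ cg            = around adj cg

  neighbourColours-update-∷ : NeighbourColoursIn c e L →
                              NeighbourColoursIn (update G c f col) e (col ∷ L)
  neighbourColours-update-∷ around =
    neighbourColours-update (λ _ → here refl) (λ adj eq → there (around adj eq))

  legal-∉ : c e ≡ nothing → NeighbourColoursIn c e L → col ∉ L → Legal G c e col
  legal-∉ free around col∉L = free , λ _ adj cf → col∉L (around adj cf)

  legal-[] : c e ≡ nothing → NeighbourColoursIn c e [] → Legal G c e col
  legal-[] free around = legal-∉ free around λ ()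

  colourable : ∀ {k} {c : Colouring G k} {L : List (Fin k)} →
               c e ≡ nothing → NeighbourColoursIn c e L → length L < k → ∃ (Legal G c e)
  colourable free around L<k =
    let (col , col∉L) = length<⇒∃∉ _ L<k in col , legal-∉ free around col∉L

  Proper : Colouring G k → Set
  Proper c = ∀ {e f col} → Adjacent G e f → c e ≡ just col → c f ≢ just col

  update-proper : Legal G c e col → Proper c → Proper (update G c e col)
  update-proper (_ , fresh) proper adj cf cg with update-just cf | update-just cg
  ... | inj₁ (refl , refl) | inj₁ (refl , _)    = proj₁ adj refl
  ... | inj₁ (refl , refl) | inj₂ cg′           = fresh _ adj cg′
  ... | inj₂ cf′           | inj₁ (refl , refl) = fresh _ (Adjacent-sym adj) cf′
  ... | inj₂ cf′           | inj₂ cg′           = proper adj cf′ cg′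

  aliceWins⇒proper-completion : ∀ {p} → AliceWins G k p c → Proper c →
                                ∃ λ c′ → Complete G c′ × Proper c′
  aliceWins⇒proper-completion (complete all) proper = _ , all , proper
  aliceWins⇒proper-completion (aliceMove e col legal win) proper =
    aliceWins⇒proper-completion win (update-proper legal proper)
  aliceWins⇒proper-completion (bobMove (e , col , legal) respond) proper =
    aliceWins⇒proper-completion (respond e col legal) (update-proper legal proper)

  clique-≤ : ∀ {k} {c : Colouring G k} → Complete G c → Proper c → IsClique G es → length es ≤ k
  clique-≤ {es = es} {k = k} all proper clique = Fin.injective⇒≤ colour-injective
    where
    colour : Fin (length es) → Fin k
    colour i = proj₁ (all (lookup es i))
    colour-injective : ∀ {i j} → colour i ≡ colour j → i ≡ j
    colour-injective {i} {j} eq with i Fin.≟ j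
    ... | yes i≡j = i≡j
    ... | no i≢j  = contradiction (trans (proj₂ (all (lookup es j))) (cong just (sym eq)))
                      (proper (AllPairs-lookup Adjacent-sym clique i≢j) (proj₂ (all (lookup es i))))

  aliceWins⇒clique-≤ : AliceWinsB- G k → IsClique G es → length es ≤ k
  aliceWins⇒clique-≤ win clique =
    let (_ , all , proper) = aliceWins⇒proper-completion win (λ _ ()) in clique-≤ all proper clique

  lineB-nice : IsClique G es → AliceWinsB- G (length es) → LineB-Nice G
  lineB-nice {es = es} clique win =
    length es , ((es , clique , refl) , λ _ → aliceWins⇒clique-≤ win) ,
    win , λ k k<ω win′ → <⇒≱ k<ω (aliceWins⇒clique-≤ win′ clique)

  module Incidence (edgesAt : V → List E)
                   (edgesAt-complete : ∀ {u e} → _∈ₑ_ G u e → e ∈ edgesAt u) where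

    coloursAt : Colouring G k → V → List (Fin k)
    coloursAt c u = mapMaybe c (edgesAt u)

    coloursAt-⊑ : ∀ {u} → c ⊑ c′ → d ∈ coloursAt c u → d ∈ coloursAt c′ u
    coloursAt-⊑ {u = u} c⊑c′ d∈ =
      let (f , f∈ , cf) = ∈-mapMaybe⁻ (edgesAt u) d∈ in ∈-mapMaybe⁺ f∈ (keeps c⊑c′ cf)

    neighbourColours-endpoints :
      NeighbourColoursIn c e (coloursAt c (proj₁ (ends e)) ++ coloursAt c (proj₂ (ends e)))
    neighbourColours-endpoints (_ , _ , inj₁ refl , u∈f) cf =
      ∈-++⁺ˡ (∈-mapMaybe⁺ (edgesAt-complete u∈f) cf)
    neighbourColours-endpoints (_ , _ , inj₂ refl , u∈f) cf =
      ∈-++⁺ʳ _ (∈-mapMaybe⁺ (edgesAt-complete u∈f) cf)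

    colourable-by-degree : ∀ {k} {c : Colouring G k} → c e ≡ nothing →
      length (edgesAt (proj₁ (ends e))) + length (edgesAt (proj₂ (ends e))) ≤ suc k →
      ∃ (Legal G c e)
    colourable-by-degree {e = e} {k = k} {c = c} free degrees =
      colourable free neighbourColours-endpoints (subst (_< k) (sym (length-++ colours₁)) bound)
      where
      colours₁ colours₂ : List (Fin k)
      colours₁ = coloursAt c (proj₁ (ends e))
      colours₂ = coloursAt c (proj₂ (ends e))
      bound : length colours₁ + length colours₂ < k
      bound = subst (_≤ k) (+-suc (length colours₁) (length colours₂))
        (s≤s⁻¹ (≤-trans (+-mono-≤ (length-mapMaybe-< (edgesAt-complete (inj₁ refl)) free)
                                  (length-mapMaybe-< (edgesAt-complete (inj₂ refl)) free))
                        degrees))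

  module Enumeration (edges : List E) (edges-complete : ∀ e → e ∈ edges) where

    uncoloured : Colouring G k → List E → ℕ
    uncoloured c es = sum (map (#nothing ∘ c) es)

    uncoloured-⊑ : c ⊑ c′ → ∀ es → uncoloured c′ es ≤ uncoloured c es
    uncoloured-⊑ c⊑c′ []       = z≤n
    uncoloured-⊑ c⊑c′ (e ∷ es) = +-mono-≤ (#nothing-anti (keeps c⊑c′)) (uncoloured-⊑ c⊑c′ es)

    uncoloured-update-< : ∀ {k} {c : Colouring G k} {e col es} → Legal G c e col → e ∈ es →
                          uncoloured (update G c e col) es < uncoloured c es
    uncoloured-update-< {es = _ ∷ es} legal (here refl) =
      +-mono-<-≤ (#nothing-fill (proj₁ legal) update-≡) (uncoloured-⊑ (legal-⊑ legal) es)
    uncoloured-update-< legal (there e∈es) =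
      +-mono-≤-< (#nothing-anti (keeps (legal-⊑ legal))) (uncoloured-update-< legal e∈es)

    first-uncoloured : (c : Colouring G k) → ∀ es → (∃ λ e → c e ≡ nothing) ⊎ All (Coloured c) es
    first-uncoloured c []       = inj₂ []
    first-uncoloured c (e ∷ es) with coloured? c e | first-uncoloured c es
    ... | inj₂ free     | _               = inj₁ (e , free)
    ... | inj₁ _        | inj₁ uncoloured = inj₁ uncoloured
    ... | inj₁ coloured | inj₂ all        = inj₂ (coloured ∷ all)

    module _ (Invariant : Colouring G k → Set)
             (invariant-update : ∀ {c e col} → Legal G c e col → Invariant c →
                                 Invariant (update G c e col))
             (invariant-colourable : ∀ {c e} → Invariant c → c e ≡ nothing → ∃ (Legal G c e))
             where

      aliceWins-bounded : ∀ N {p c} → uncoloured c edges < N → Invariant c → AliceWins G k p c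
      aliceWins-bounded (suc N) {p} {c} c<N inv = play (first-uncoloured c edges) p
        where
        continue : ∀ {e col p′} → Legal G c e col → AliceWins G k p′ (update G c e col)
        continue legal = aliceWins-bounded N
          (≤-trans (uncoloured-update-< legal (edges-complete _)) (s≤s⁻¹ c<N))
          (invariant-update legal inv)
        play : (∃ λ e → c e ≡ nothing) ⊎ All (Coloured c) edges → ∀ p → AliceWins G k p c
        play (inj₂ coloured)   _     = complete λ e → All.lookup coloured (edges-complete e)
        play (inj₁ (e , free)) bob   = bobMove (e , invariant-colourable inv free) λ _ _ → continue
        play (inj₁ (e , free)) alice =
          let (col , legal) = invariant-colourable inv free in aliceMove e col legal (continue legal)

      aliceWins-invariant : ∀ {p c} → Invariant c → AliceWins G k p c
      aliceWins-invariant {c = c} = aliceWins-bounded (suc (uncoloured c edges)) ≤-refl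

module ShootingStar (m n p : ℕ) where

  G : Graph
  G = ShootingStarPlusIsolated m n p

  open EdgeColouring G

  edgesAt : SSVertex m n p → List (SSEdge m n)
  edgesAt w       = wv ∷ tabulate wx
  edgesAt v       = wv ∷ va ∷ tabulate vy
  edgesAt a       = va ∷ ab ∷ []
  edgesAt b       = ab ∷ []
  edgesAt (x i)   = wx i ∷ []
  edgesAt (y j)   = vy j ∷ []
  edgesAt (iso _) = []

  edgesAt-complete : ∀ {u e} → _∈ₑ_ G u e → e ∈ edgesAt u
  edgesAt-complete {e = wv}   (inj₁ refl) = here refl
  edgesAt-complete {e = wv}   (inj₂ refl) = here refl
  edgesAt-complete {e = va}   (inj₁ refl) = there (here refl)
  edgesAt-complete {e = va}   (inj₂ refl) = here refl
  edgesAt-complete {e = ab}   (inj₁ refl) = there (here refl)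
  edgesAt-complete {e = ab}   (inj₂ refl) = here refl
  edgesAt-complete {e = wx i} (inj₁ refl) = there (∈-tabulate⁺ i)
  edgesAt-complete {e = wx i} (inj₂ refl) = here refl
  edgesAt-complete {e = vy j} (inj₁ refl) = there (there (∈-tabulate⁺ j))
  edgesAt-complete {e = vy j} (inj₂ refl) = here refl

  open Incidence edgesAt edgesAt-complete

  edges : List (SSEdge m n)
  edges = edgesAt w ++ edgesAt v ++ edgesAt a

  edges-complete : ∀ e → e ∈ edges
  edges-complete wv     = ∈-++⁺ˡ (edgesAt-complete (inj₁ refl))
  edges-complete (wx _) = ∈-++⁺ˡ (edgesAt-complete (inj₁ refl))
  edges-complete va     = ∈-++⁺ʳ (edgesAt w) (∈-++⁺ˡ (edgesAt-complete (inj₁ refl)))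
  edges-complete (vy _) = ∈-++⁺ʳ (edgesAt w) (∈-++⁺ˡ (edgesAt-complete (inj₁ refl)))
  edges-complete ab     = ∈-++⁺ʳ (edgesAt w) (∈-++⁺ʳ (edgesAt v) (edgesAt-complete (inj₁ refl)))

  open Enumeration edges edges-complete

  degree-w : length (edgesAt w) ≡ suc m
  degree-w = cong suc (length-tabulate wx)

  degree-v : length (edgesAt v) ≡ suc (suc n)
  degree-v = cong (λ ℓ → suc (suc ℓ)) (length-tabulate vy)

  star-w : IsClique G (edgesAt w)
  star-w = clique-at (inj₁ refl ∷ All.tabulate⁺ λ _ → inj₁ refl)
                     (All.tabulate⁺ (λ _ ()) ∷ AllPairs.tabulate⁺ λ i≢j → λ { refl → i≢j refl })

  star-v : IsClique G (edgesAt v)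
  star-v = clique-at (inj₂ refl ∷ inj₁ refl ∷ All.tabulate⁺ λ _ → inj₁ refl)
                     (((λ ()) ∷ All.tabulate⁺ (λ _ ())) ∷ All.tabulate⁺ (λ _ ()) ∷
                      AllPairs.tabulate⁺ λ i≢j → λ { refl → i≢j refl })

  largest-star : ∃ λ es → IsClique G es × suc m ≤ length es × suc (suc n) ≤ length es
  largest-star with ≤-total (suc m) (suc (suc n))
  ... | inj₁ m<n+1 = edgesAt v , star-v , subst (suc m ≤_) (sym degree-v) m<n+1 ,
                     ≤-reflexive (sym degree-v)
  ... | inj₂ n+1<m = edgesAt w , star-w , ≤-reflexive (sym degree-w) ,
                     subst (suc (suc n) ≤_) (sym degree-w) n+1<m

  wv≁ab : ¬ Adjacent G wv ab
  wv≁ab (_ , _ , inj₁ refl , inj₁ ())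
  wv≁ab (_ , _ , inj₁ refl , inj₂ ())
  wv≁ab (_ , _ , inj₂ refl , inj₁ ())
  wv≁ab (_ , _ , inj₂ refl , inj₂ ())

  va≁wx : ∀ {i} → ¬ Adjacent G va (wx i)
  va≁wx (_ , _ , inj₁ refl , inj₁ ())
  va≁wx (_ , _ , inj₁ refl , inj₂ ())
  va≁wx (_ , _ , inj₂ refl , inj₁ ())
  va≁wx (_ , _ , inj₂ refl , inj₂ ())

  ab≁vy : ∀ {j} → ¬ Adjacent G ab (vy j)
  ab≁vy (_ , _ , inj₁ refl , inj₁ ())
  ab≁vy (_ , _ , inj₁ refl , inj₂ ())
  ab≁vy (_ , _ , inj₂ refl , inj₁ ())
  ab≁vy (_ , _ , inj₂ refl , inj₂ ())

  ShieldedVA : Colouring G k → Set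
  ShieldedVA c = ∃ λ d → c ab ≡ just d × d ∈ coloursAt c v

  VASafe : Colouring G k → Set
  VASafe c = Coloured c va ⊎ ShieldedVA c

  Settled : Colouring G k → Set
  Settled c = Coloured c wv × VASafe c

  vaSafe-⊑ : ∀ {c c′ : Colouring G k} → c ⊑ c′ → VASafe c → VASafe c′
  vaSafe-⊑ c⊑c′ (inj₁ coloured)       = inj₁ (coloured-⊑ c⊑c′ coloured)
  vaSafe-⊑ c⊑c′ (inj₂ (d , cab , d∈)) = inj₂ (d , keeps c⊑c′ cab , coloursAt-⊑ {u = v} c⊑c′ d∈)

  settled-⊑ : ∀ {c c′ : Colouring G k} → c ⊑ c′ → Settled c → Settled c′
  settled-⊑ c⊑c′ (wv-coloured , safe) = coloured-⊑ c⊑c′ wv-coloured , vaSafe-⊑ c⊑c′ safe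

  shielded-neighbourColours : ∀ {c : Colouring G k} → ShieldedVA c →
                              NeighbourColoursIn c va (coloursAt c v)
  shielded-neighbourColours {c = c} (d , cab , d∈) adj cf
    with ∈-++⁻ (coloursAt c v) {coloursAt c a} (neighbourColours-endpoints {c = c} {e = va} adj cf)
  ... | inj₁ at-v = at-v
  ... | inj₂ at-a with ∈-mapMaybe⁻ {f = c} (edgesAt a) at-a
  ...   | _ , here refl , cva          = ∈-mapMaybe⁺ {f = c} {ss = edgesAt v} (there (here refl)) cva
  ...   | _ , there (here refl) , cab′ =
    subst (_∈ coloursAt c v) (just-injective (trans (sym cab) cab′)) d∈

  module Strategy (k : ℕ) (m<k : suc m ≤ k) (n+1<k : suc (suc n) ≤ k) where

    2≤k : 2 ≤ k
    2≤k = ≤-trans (s≤s (s≤s z≤n)) n+1<k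

    two-x⇒3≤k : ∀ {i i′ : Fin m} → i ≢ i′ → 3 ≤ k
    two-x⇒3≤k i≢i′ = ≤-trans (s≤s (distinct⇒2≤ i≢i′)) m<k

    some-y⇒3≤k : Fin n → 3 ≤ k
    some-y⇒3≤k j = ≤-trans (s≤s (s≤s (≤-trans (s≤s z≤n) (Fin.toℕ<n j)))) n+1<k

    degree-w≤k : length (edgesAt w) ≤ k
    degree-w≤k = subst (_≤ k) (sym degree-w) m<k

    degree-v≤k : length (edgesAt v) ≤ k
    degree-v≤k = subst (_≤ k) (sym degree-v) n+1<k

    leaf-degrees : ∀ {d} → d ≤ k → d + 1 ≤ suc k
    leaf-degrees {d} d≤k = subst (_≤ suc k) (+-comm 1 d) (s≤s d≤k)

    settled-colourable : ∀ {c : Colouring G k} {e} → Settled c → c e ≡ nothing → ∃ (Legal G c e)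
    settled-colourable {e = wv}   ((_ , cwv) , _)      free = contradiction free (just⇒≢nothing cwv)
    settled-colourable {e = va}   (_ , inj₁ (_ , cva)) free = contradiction free (just⇒≢nothing cva)
    settled-colourable {c} {va}   (_ , inj₂ shielded)  free =
      colourable free (shielded-neighbourColours {c = c} shielded)
        (≤-trans (length-mapMaybe-< {f = c} {ss = edgesAt v} (there (here refl)) free) degree-v≤k)
    settled-colourable {e = ab}   _ free = colourable-by-degree free (leaf-degrees 2≤k)
    settled-colourable {e = wx _} _ free = colourable-by-degree free (leaf-degrees degree-w≤k)
    settled-colourable {e = vy _} _ free = colourable-by-degree free (leaf-degrees degree-v≤k)

    settled-wins : ∀ {p} {c : Colouring G k} → Settled c → AliceWins G k p c
    settled-wins = aliceWins-invariant Settled (λ legal → settled-⊑ (legal-⊑ legal)) settled-colourable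

    colour-wv : ∀ {c : Colouring G k} {L} → VASafe c → NeighbourColoursIn c wv L → length L < k →
                AliceWins G k alice c
    colour-wv {c} safe around L<k with coloured? c wv
    ... | inj₁ coloured = settled-wins (coloured , safe)
    ... | inj₂ cwv      =
      let (col , legal) = colourable cwv around L<k in
      aliceMove wv col legal
        (settled-wins ((col , update-≡ {c = c} {e = wv}) , vaSafe-⊑ (legal-⊑ legal) safe))

    reply-wv : ∀ col → AliceWins G k alice (update G (emptyColouring G) wv col)
    reply-wv col =
      let (col′ , legal) = colourable {e = va} {c = update G (emptyColouring G) wv col} refl
                             (neighbourColours-update-∷ (neighbourColours-empty {L = []})) 2≤k in
      aliceMove va col′ legal (settled-wins ((col , refl) , inj₁ (col′ , refl)))

    reply-va : ∀ col → AliceWins G k alice (update G (emptyColouring G) va col)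
    reply-va col =
      colour-wv (inj₁ (col , refl)) (neighbourColours-update-∷ (neighbourColours-empty {L = []})) 2≤k

    reply-ab : ∀ col → AliceWins G k alice (update G (emptyColouring G) ab col)
    reply-ab col =
      aliceMove wv col (legal-[] refl (neighbourColours-update (⊥-elim ∘ wv≁ab) neighbourColours-empty))
        (settled-wins ((col , refl) , inj₂ (col , refl , here refl)))

    reply-wx : ∀ i col → AliceWins G k alice (update G (emptyColouring G) (wx i) col)
    reply-wx i col =
      aliceMove va col va-legal (bobMove (wv , colourable {e = wv} {c = c₂} refl around-wv 2≤k) respond)
      where
      c₁ c₂ : Colouring G k
      c₁ = update G (emptyColouring G) (wx i) col
      c₂ = update G c₁ va col
      va-legal : Legal G c₁ va col
      va-legal = legal-[] refl (neighbourColours-update (⊥-elim ∘ va≁wx) neighbourColours-empty)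
      around-wv : NeighbourColoursIn c₂ wv (col ∷ [])
      around-wv = neighbourColours-update (λ _ → here refl) (neighbourColours-update-∷ neighbourColours-empty)
      wx-coloured : c₂ (wx i) ≡ just col
      wx-coloured = keeps (legal-⊑ va-legal) {e = wx i} (update-≡ {c = emptyColouring G} {e = wx i})
      va-safe : ∀ {e col′} → Legal G c₂ e col′ → VASafe (update G c₂ e col′)
      va-safe legal = inj₁ (coloured-⊑ {e = va} (legal-⊑ legal) (col , refl))
      respond : ∀ e col′ → Legal G c₂ e col′ → AliceWins G k alice (update G c₂ e col′)
      respond wv      col′ legal    = settled-wins ((col′ , refl) , va-safe legal)
      respond va      _    (() , _)
      respond ab      _    legal    =
        colour-wv (va-safe legal) (neighbourColours-update (⊥-elim ∘ wv≁ab) around-wv) 2≤k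
      respond (wx i′) _    legal    = colour-wv (va-safe legal) (neighbourColours-update-∷ around-wv)
        (two-x⇒3≤k {i} {i′} λ { refl → just⇒≢nothing wx-coloured (proj₁ legal) })
      respond (vy j)  _    legal    =
        colour-wv (va-safe legal) (neighbourColours-update-∷ around-wv) (some-y⇒3≤k j)

    reply-vy : ∀ j col → AliceWins G k alice (update G (emptyColouring G) (vy j) col)
    reply-vy j col =
      aliceMove ab col ab-legal (bobMove (wv , colourable {e = wv} {c = c₂} refl around-wv 2≤k) respond)
      where
      c₁ c₂ : Colouring G k
      c₁ = update G (emptyColouring G) (vy j) col
      c₂ = update G c₁ ab col
      ab-legal : Legal G c₁ ab col
      ab-legal = legal-[] refl (neighbourColours-update (⊥-elim ∘ ab≁vy) neighbourColours-empty)
      around-wv : NeighbourColoursIn c₂ wv (col ∷ [])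
      around-wv = neighbourColours-update (λ _ → here refl) (neighbourColours-update-∷ neighbourColours-empty)
      vy-coloured : c₂ (vy j) ≡ just col
      vy-coloured = keeps (legal-⊑ ab-legal) {e = vy j} (update-≡ {c = emptyColouring G} {e = vy j})
      shielded : ShieldedVA c₂
      shielded = col , refl ,
        ∈-mapMaybe⁺ {f = c₂} {ss = edgesAt v} (there (there (∈-tabulate⁺ j))) vy-coloured
      respond : ∀ e col′ → Legal G c₂ e col′ → AliceWins G k alice (update G c₂ e col′)
      respond _ _ legal = colour-wv (vaSafe-⊑ (legal-⊑ legal) (inj₂ shielded))
                                    (neighbourColours-update-∷ around-wv) (some-y⇒3≤k j)

    reply : ∀ e col → AliceWins G k alice (update G (emptyColouring G) e col)
    reply wv     = reply-wv
    reply va     = reply-va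
    reply ab     = reply-ab
    reply (wx i) = reply-wx i
    reply (vy j) = reply-vy j

    aliceWins : AliceWinsB- G k
    aliceWins = bobMove (ab , first-move) λ e col _ → reply e col
      where
      first-move : ∃ (Legal G (emptyColouring G) ab)
      first-move = colourable {L = []} refl neighbourColours-empty (≤-trans (s≤s z≤n) 2≤k)

lemma56 : (m n p : ℕ) → LineB-Nice (ShootingStarPlusIsolated m n p)
lemma56 m n p =
  let (es , clique , m<ω , n+1<ω) = largest-star in lineB-nice clique (aliceWins (length es) m<ω n+1<ω)
  where
  open EdgeColouring (ShootingStarPlusIsolated m n p) using (lineB-nice)
  open ShootingStar m n p using (largest-star; module Strategy)
  open Strategy using (aliceWins)
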